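{- In $\mathsf{CNOT}$, $\Omega\otimes\Omega=\Omega$, where $\Omega:=(|1\rangle\otimes|1\rangle)\,\mathsf{cnot}\,(\langle1|\otimes\langle1|):0\to0$.
   Context: $\mathsf{CNOT}$ is the strict symmetric monoidal category with objects the natural numbers ($n\otimes m=n+m$) generated by $\mathsf{cnot}:2\to2$, $|1\rangle:0\to1$, $\langle1|:1\to0$ (and the symmetry $\sigma$) modulo exactly the following identities, where composition is diagrammatic ($fg$ = first $f$ then $g$) and $C_{i\to j}$ is the cnot with control wire $i$ and target wire $j$ (wires numbered top to bottom; $\mathsf{cnot}=C_{1\to2}$): $C_{1\to2}C_{2\to1}C_{1\to2}=\sigma$; $C_{1\to2}C_{1\to2}=1_2$; $C_{2\to1}C_{2\to3}=C_{2\to3}C_{2\to1}$; $(|1\rangle\otimes1)C_{1\to2}=(|1\rangle\otimes1)C_{1\to2}(\langle1|\otimes1)(|1\rangle\otimes1)$ and $C_{1\to2}(\langle1|\otimes1)=(\langle1|\otimes1)(|1\rangle\otimes1)C_{1\to2}(\langle1|\otimes1)$; $C_{1\to2}C_{3\to2}=C_{3\to2}C_{1\to2}$; $|1\rangle\langle1|=1_0$; $(|1\rangle\otimes|1\rangle\otimes1)C_{1\to2}C_{2\to3}(\langle1|\otimes1_2)=(|1\rangle\otimes|1\rangle\otimes1)C_{1\to2}(\langle1|\otimes1_2)$ and $(|1\rangle\otimes1_2)C_{2\to3}C_{1\to2}(\langle1|\otimes\langle1|\otimes1)=(|1\rangle\otimes1_2)C_{1\to2}(\langle1|\otimes\langle1|\otimes1)$;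 $C_{1\to2}C_{2\to3}C_{1\to2}=C_{2\to3}C_{1\to3}$; $(|1\rangle\otimes|1\rangle\otimes1)C_{1\to2}(\langle1|\otimes\langle1|\otimes1)=(|1\rangle\otimes|1\rangle\otimes\langle1|)C_{1\to2}(\langle1|\otimes\langle1|\otimes|1\rangle)$. -}

module Defs where

open import Data.Nat using (ℕ; _+_)
open import Data.Nat.Properties using (+-assoc; +-identityʳ)
open import Relation.Binary.PropositionalEquality using (_≡_; refl; sym; subst₂)

infixl 5 _⨾_
infixr 6 _⊗_

-- Syntax of morphisms of the free strict symmetric monoidal category
-- (objects ℕ, n ⊗ m = n + m) on the generators cnot : 2 → 2,
-- ket1 = |1⟩ : 0 → 1, bra1 = ⟨1| : 1 → 0.
-- Composition f ⨾ g is diagrammatic (first f, then g).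
data Tm : ℕ → ℕ → Set where
  id   : (n : ℕ) → Tm n n
  _⨾_  : ∀ {a b c} → Tm a b → Tm b c → Tm a c
  _⊗_  : ∀ {a b c d} → Tm a b → Tm c d → Tm (a + c) (b + d)
  sym' : (m n : ℕ) → Tm (m + n) (n + m)
  cnot : Tm 2 2
  ket1 : Tm 0 1
  bra1 : Tm 1 0

cast : ∀ {a a' b b'} → a ≡ a' → b ≡ b' → Tm a b → Tm a' b'
cast p q f = subst₂ Tm p q f

σ : Tm 2 2
σ = sym' 1 1

C12₂ : Tm 2 2
C12₂ = cnot

C21₂ : Tm 2 2
C21₂ = σ ⨾ cnot ⨾ σ

C12 : Tm 3 3
C12 = cnot ⊗ id 1

C21 : Tm 3 3
C21 = C21₂ ⊗ id 1

C23 : Tm 3 3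
C23 = id 1 ⊗ cnot

C32 : Tm 3 3
C32 = id 1 ⊗ C21₂

C13 : Tm 3 3
C13 = (id 1 ⊗ σ) ⨾ (cnot ⊗ id 1) ⨾ (id 1 ⊗ σ)

infix 4 _≈_

-- The congruence generated by the strict symmetric monoidal category
-- axioms together with exactly the defining identities of CNOT.
data _≈_ : ∀ {a b} → Tm a b → Tm a b → Set where
  ≈-refl  : ∀ {a b} {f : Tm a b} → f ≈ f
  ≈-sym   : ∀ {a b} {f g : Tm a b} → f ≈ g → g ≈ f
  ≈-trans : ∀ {a b} {f g h : Tm a b} → f ≈ g → g ≈ h → f ≈ h
  ⨾-cong  : ∀ {a b c} {f f' : Tm a b} {g g' : Tm b c} → f ≈ f' → g ≈ g' → f ⨾ g ≈ f' ⨾ g'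
  ⊗-cong  : ∀ {a b c d} {f f' : Tm a b} {g g' : Tm c d} → f ≈ f' → g ≈ g' → f ⊗ g ≈ f' ⊗ g'
  ⨾-assoc : ∀ {a b c d} (f : Tm a b) (g : Tm b c) (h : Tm c d) → (f ⨾ g) ⨾ h ≈ f ⨾ (g ⨾ h)
  ⨾-idˡ   : ∀ {a b} (f : Tm a b) → id a ⨾ f ≈ f
  ⨾-idʳ   : ∀ {a b} (f : Tm a b) → f ⨾ id b ≈ f
  ⊗-id    : (a b : ℕ) → id a ⊗ id b ≈ id (a + b)
  interchange : ∀ {a b c d e f'} (f : Tm a b) (g : Tm b c) (h : Tm d e) (k : Tm e f') →
                (f ⨾ g) ⊗ (h ⨾ k) ≈ (f ⊗ h) ⨾ (g ⊗ k)
  ⊗-assoc : ∀ {a b c a' b' c'} (f : Tm a a') (g : Tm b b') (h : Tm c c') →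
            cast (+-assoc a b c) (+-assoc a' b' c') ((f ⊗ g) ⊗ h) ≈ f ⊗ (g ⊗ h)
  ⊗-unitˡ : ∀ {a b} (f : Tm a b) → id 0 ⊗ f ≈ f
  ⊗-unitʳ : ∀ {a b} (f : Tm a b) → cast (+-identityʳ a) (+-identityʳ b) (f ⊗ id 0) ≈ f
  σ-nat   : ∀ {a b c d} (f : Tm a b) (g : Tm c d) → (f ⊗ g) ⨾ sym' b d ≈ sym' a c ⨾ (g ⊗ f)
  σ-inv   : (m n : ℕ) → sym' m n ⨾ sym' n m ≈ id (m + n)
  σ-unit  : (m : ℕ) → cast (+-identityʳ m) refl (sym' m 0) ≈ id m
  σ-hex₁  : (m n p : ℕ) →
            sym' m (n + p) ≈
            cast (+-assoc m n p) refl
              ((sym' m n ⊗ id p) ⨾ cast (sym (+-assoc n m p)) (sym (+-assoc n p m)) (id n ⊗ sym' m p))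
  σ-hex₂  : (m n p : ℕ) →
            sym' (m + n) p ≈
            cast (sym (+-assoc m n p)) (sym (+-assoc m p n)) (id m ⊗ sym' n p)
              ⨾ cast refl (+-assoc p m n) (sym' m p ⊗ id n)
  r1  : C12₂ ⨾ C21₂ ⨾ C12₂ ≈ σ
  r2  : C12₂ ⨾ C12₂ ≈ id 2
  r3  : C21 ⨾ C23 ≈ C23 ⨾ C21
  r4a : (ket1 ⊗ id 1) ⨾ C12₂ ≈ (ket1 ⊗ id 1) ⨾ C12₂ ⨾ (bra1 ⊗ id 1) ⨾ (ket1 ⊗ id 1)
  r4b : C12₂ ⨾ (bra1 ⊗ id 1) ≈ (bra1 ⊗ id 1) ⨾ (ket1 ⊗ id 1) ⨾ C12₂ ⨾ (bra1 ⊗ id 1)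
  r5  : C12 ⨾ C32 ≈ C32 ⨾ C12
  r6  : ket1 ⨾ bra1 ≈ id 0
  r7a : (ket1 ⊗ ket1 ⊗ id 1) ⨾ C12 ⨾ C23 ⨾ (bra1 ⊗ id 2) ≈ (ket1 ⊗ ket1 ⊗ id 1) ⨾ C12 ⨾ (bra1 ⊗ id 2)
  r7b : (ket1 ⊗ id 2) ⨾ C23 ⨾ C12 ⨾ (bra1 ⊗ bra1 ⊗ id 1) ≈ (ket1 ⊗ id 2) ⨾ C12 ⨾ (bra1 ⊗ bra1 ⊗ id 1)
  r8  : C12 ⨾ C23 ⨾ C12 ≈ C23 ⨾ C13
  r9  : (ket1 ⊗ ket1 ⊗ id 1) ⨾ C12 ⨾ (bra1 ⊗ bra1 ⊗ id 1) ≈ (ket1 ⊗ ket1 ⊗ bra1) ⨾ C12₂ ⨾ (bra1 ⊗ bra1 ⊗ ket1)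

Ω : Tm 0 0
Ω = (ket1 ⊗ ket1) ⨾ cnot ⨾ (bra1 ⊗ bra1)

-- Write ¬ := (|1⟩ ⊗ 1) cnot (⟨1| ⊗ 1) and |0⟩ := |1⟩ ¬, so that Ω = |0⟩⟨1|.
-- Relation 7a says that a cnot whose control is |0⟩ acts as the identity,
-- hence (|0⟩ ⊗ |0⟩) = (|0⟩ ⊗ |0⟩) cnot. Inserting this cnot into
-- Ω ⊗ Ω = (|0⟩ ⊗ |0⟩)(⟨1| ⊗ ⟨1|) and pushing it through ⟨1| ⊗ 1 by relation 4b
-- turns the second factor into |0⟩ ¬ ⟨1| = |1⟩ ¬ ¬ ⟨1| = |1⟩⟨1| = 1₀.
module Submission where

open import Level using (0ℓ)
open import Data.Nat using (ℕ)
open import Relation.Binary.Bundles using (Setoid)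
import Relation.Binary.Reasoning.Setoid as SetoidReasoning

open import Defs

Tm-setoid : ℕ → ℕ → Setoid 0ℓ 0ℓ
Tm-setoid a b = record
  { Carrier       = Tm a b
  ; _≈_           = _≈_
  ; isEquivalence = record { refl = ≈-refl ; sym = ≈-sym ; trans = ≈-trans }
  }

module ≈-Reasoning {a b : ℕ} = SetoidReasoning (Tm-setoid a b)
open ≈-Reasoning

⊗-of-states : ∀ {a b} (f : Tm 0 a) (g : Tm 0 b) → f ⊗ g ≈ g ⨾ (f ⊗ id b)
⊗-of-states {b = b} f g = begin
  f ⊗ g                   ≈⟨ ⊗-cong (⨾-idˡ f) (⨾-idʳ g) ⟨
  (id 0 ⨾ f) ⊗ (g ⨾ id b) ≈⟨ interchange (id 0) f g (id b) ⟩
  (id 0 ⊗ g) ⨾ (f ⊗ id b) ≈⟨ ⨾-cong (⊗-unitˡ g) ≈-refl ⟩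
  g ⨾ (f ⊗ id b)          ∎

⊗-of-effects : ∀ {a b} (f : Tm a 0) (g : Tm b 0) → f ⊗ g ≈ (f ⊗ id b) ⨾ g
⊗-of-effects {b = b} f g = begin
  f ⊗ g                   ≈⟨ ⊗-cong (⨾-idʳ f) (⨾-idˡ g) ⟨
  (f ⨾ id 0) ⊗ (id b ⨾ g) ≈⟨ interchange f (id 0) (id b) g ⟩
  (f ⊗ id b) ⨾ (id 0 ⊗ g) ≈⟨ ⨾-cong ≈-refl (⊗-unitˡ g) ⟩
  (f ⊗ id b) ⨾ g          ∎

ket1⊗-⨾-bra1⊗id : ∀ {a n} (f : Tm a n) → (ket1 ⊗ f) ⨾ (bra1 ⊗ id n) ≈ f
ket1⊗-⨾-bra1⊗id {n = n} f = begin
  (ket1 ⊗ f) ⨾ (bra1 ⊗ id n) ≈⟨ interchange ket1 bra1 f (id n) ⟨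
  (ket1 ⨾ bra1) ⊗ (f ⨾ id n) ≈⟨ ⊗-cong r6 (⨾-idʳ f) ⟩
  id 0 ⊗ f                   ≈⟨ ⊗-unitˡ f ⟩
  f                          ∎

not : Tm 1 1
not = (ket1 ⊗ id 1) ⨾ cnot ⨾ (bra1 ⊗ id 1)

ket0 : Tm 0 1
ket0 = ket1 ⨾ not

Ω≈ket0⨾bra1 : Ω ≈ ket0 ⨾ bra1
Ω≈ket0⨾bra1 = begin
  (ket1 ⊗ ket1) ⨾ cnot ⨾ (bra1 ⊗ bra1)
    ≈⟨ ⨾-cong (⨾-cong (⊗-of-states ket1 ket1) ≈-refl) (⊗-of-effects bra1 bra1) ⟩
  ket1 ⨾ (ket1 ⊗ id 1) ⨾ cnot ⨾ ((bra1 ⊗ id 1) ⨾ bra1)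
    ≈⟨ ⨾-assoc _ _ _ ⟨
  ket1 ⨾ (ket1 ⊗ id 1) ⨾ cnot ⨾ (bra1 ⊗ id 1) ⨾ bra1
    ≈⟨ ⨾-cong (⨾-cong (⨾-assoc _ _ _) ≈-refl) ≈-refl ⟩
  ket1 ⨾ ((ket1 ⊗ id 1) ⨾ cnot) ⨾ (bra1 ⊗ id 1) ⨾ bra1
    ≈⟨ ⨾-cong (⨾-assoc _ _ _) ≈-refl ⟩
  ket0 ⨾ bra1 ∎

ket1⊗id-⨾-cnot : (ket1 ⊗ id 1) ⨾ cnot ≈ not ⨾ (ket1 ⊗ id 1)
ket1⊗id-⨾-cnot = r4a

cnot-⨾-bra1⊗id : cnot ⨾ (bra1 ⊗ id 1) ≈ (bra1 ⊗ id 1) ⨾ not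
cnot-⨾-bra1⊗id = begin
  cnot ⨾ (bra1 ⊗ id 1)                                   ≈⟨ r4b ⟩
  (bra1 ⊗ id 1) ⨾ (ket1 ⊗ id 1) ⨾ cnot ⨾ (bra1 ⊗ id 1) ≈⟨ ⨾-cong (⨾-assoc _ _ _) ≈-refl ⟩
  (bra1 ⊗ id 1) ⨾ ((ket1 ⊗ id 1) ⨾ cnot) ⨾ (bra1 ⊗ id 1) ≈⟨ ⨾-assoc _ _ _ ⟩
  (bra1 ⊗ id 1) ⨾ not                                    ∎

not-involutive : not ⨾ not ≈ id 1
not-involutive = begin
  not ⨾ not                                     ≈⟨ ⨾-assoc _ _ _ ⟨
  not ⨾ ((ket1 ⊗ id 1) ⨾ cnot) ⨾ (bra1 ⊗ id 1)  ≈⟨ ⨾-cong (⨾-assoc _ _ _) ≈-refl ⟨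
  not ⨾ (ket1 ⊗ id 1) ⨾ cnot ⨾ (bra1 ⊗ id 1)    ≈⟨ ⨾-cong (⨾-cong ket1⊗id-⨾-cnot ≈-refl) ≈-refl ⟨
  (ket1 ⊗ id 1) ⨾ cnot ⨾ cnot ⨾ (bra1 ⊗ id 1)   ≈⟨ ⨾-cong (⨾-assoc _ _ _) ≈-refl ⟩
  (ket1 ⊗ id 1) ⨾ (cnot ⨾ cnot) ⨾ (bra1 ⊗ id 1) ≈⟨ ⨾-cong (⨾-cong ≈-refl r2) ≈-refl ⟩
  (ket1 ⊗ id 1) ⨾ id 2 ⨾ (bra1 ⊗ id 1)          ≈⟨ ⨾-cong (⨾-idʳ _) ≈-refl ⟩
  (ket1 ⊗ id 1) ⨾ (bra1 ⊗ id 1)                 ≈⟨ ket1⊗-⨾-bra1⊗id (id 1) ⟩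
  id 1                                          ∎

ket0⨾not : ket0 ⨾ not ≈ ket1
ket0⨾not = begin
  ket1 ⨾ not ⨾ not   ≈⟨ ⨾-assoc _ _ _ ⟩
  ket1 ⨾ (not ⨾ not) ≈⟨ ⨾-cong ≈-refl not-involutive ⟩
  ket1 ⨾ id 1        ≈⟨ ⨾-idʳ ket1 ⟩
  ket1               ∎

ket1⊗ket1-⨾-cnot : (ket1 ⊗ ket1) ⨾ cnot ≈ ket1 ⊗ ket0
ket1⊗ket1-⨾-cnot = begin
  (ket1 ⊗ ket1) ⨾ cnot          ≈⟨ ⨾-cong (⊗-of-states ket1 ket1) ≈-refl ⟩
  ket1 ⨾ (ket1 ⊗ id 1) ⨾ cnot   ≈⟨ ⨾-assoc _ _ _ ⟩
  ket1 ⨾ ((ket1 ⊗ id 1) ⨾ cnot) ≈⟨ ⨾-cong ≈-refl ket1⊗id-⨾-cnot ⟩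
  ket1 ⨾ (not ⨾ (ket1 ⊗ id 1))  ≈⟨ ⨾-assoc _ _ _ ⟨
  ket0 ⨾ (ket1 ⊗ id 1)          ≈⟨ ⊗-of-states ket1 ket0 ⟨
  ket1 ⊗ ket0                   ∎

ket1⊗ket1⊗id-⨾-C12 : (ket1 ⊗ ket1 ⊗ id 1) ⨾ C12 ≈ ket1 ⊗ ket0 ⊗ id 1
ket1⊗ket1⊗id-⨾-C12 = begin
  (ket1 ⊗ ket1 ⊗ id 1) ⨾ (cnot ⊗ id 1)   ≈⟨ ⨾-cong (⊗-assoc ket1 ket1 (id 1)) ≈-refl ⟨
  ((ket1 ⊗ ket1) ⊗ id 1) ⨾ (cnot ⊗ id 1) ≈⟨ interchange _ _ _ _ ⟨
  ((ket1 ⊗ ket1) ⨾ cnot) ⊗ (id 1 ⨾ id 1) ≈⟨ ⊗-cong ket1⊗ket1-⨾-cnot (⨾-idˡ _) ⟩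
  (ket1 ⊗ ket0) ⊗ id 1                   ≈⟨ ⊗-assoc ket1 ket0 (id 1) ⟩
  ket1 ⊗ ket0 ⊗ id 1                     ∎

-- Conjugating by |1⟩ ⊗ – and ⟨1| ⊗ 1 places the |0⟩-controlled cnot inside relation 7a.
ket0⊗id-⨾-cnot : (ket0 ⊗ id 1) ⨾ cnot ≈ ket0 ⊗ id 1
ket0⊗id-⨾-cnot = begin
  (ket0 ⊗ id 1) ⨾ cnot
    ≈⟨ ket1⊗-⨾-bra1⊗id _ ⟨
  (ket1 ⊗ ((ket0 ⊗ id 1) ⨾ cnot)) ⨾ (bra1 ⊗ id 2)
    ≈⟨ ⨾-cong (⊗-cong (⨾-idʳ ket1) ≈-refl) ≈-refl ⟨
  ((ket1 ⨾ id 1) ⊗ ((ket0 ⊗ id 1) ⨾ cnot)) ⨾ (bra1 ⊗ id 2)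
    ≈⟨ ⨾-cong (interchange _ _ _ _) ≈-refl ⟩
  (ket1 ⊗ ket0 ⊗ id 1) ⨾ C23 ⨾ (bra1 ⊗ id 2)
    ≈⟨ ⨾-cong (⨾-cong ket1⊗ket1⊗id-⨾-C12 ≈-refl) ≈-refl ⟨
  (ket1 ⊗ ket1 ⊗ id 1) ⨾ C12 ⨾ C23 ⨾ (bra1 ⊗ id 2)
    ≈⟨ r7a ⟩
  (ket1 ⊗ ket1 ⊗ id 1) ⨾ C12 ⨾ (bra1 ⊗ id 2)
    ≈⟨ ⨾-cong ket1⊗ket1⊗id-⨾-C12 ≈-refl ⟩
  (ket1 ⊗ ket0 ⊗ id 1) ⨾ (bra1 ⊗ id 2)
    ≈⟨ ket1⊗-⨾-bra1⊗id _ ⟩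
  ket0 ⊗ id 1 ∎

ket0⊗ket0-⨾-cnot : (ket0 ⊗ ket0) ⨾ cnot ≈ ket0 ⊗ ket0
ket0⊗ket0-⨾-cnot = begin
  (ket0 ⊗ ket0) ⨾ cnot          ≈⟨ ⨾-cong (⊗-of-states ket0 ket0) ≈-refl ⟩
  ket0 ⨾ (ket0 ⊗ id 1) ⨾ cnot   ≈⟨ ⨾-assoc _ _ _ ⟩
  ket0 ⨾ ((ket0 ⊗ id 1) ⨾ cnot) ≈⟨ ⨾-cong ≈-refl ket0⊗id-⨾-cnot ⟩
  ket0 ⨾ (ket0 ⊗ id 1)          ≈⟨ ⊗-of-states ket0 ket0 ⟨
  ket0 ⊗ ket0                   ∎

ket0⊗ket0-⨾-bra1⊗bra1 :
  (ket0 ⊗ ket0) ⨾ (bra1 ⊗ bra1) ≈ (ket0 ⊗ ket0) ⨾ (bra1 ⊗ id 1) ⨾ (not ⨾ bra1)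
ket0⊗ket0-⨾-bra1⊗bra1 = begin
  (ket0 ⊗ ket0) ⨾ (bra1 ⊗ bra1)
    ≈⟨ ⨾-cong (≈-sym ket0⊗ket0-⨾-cnot) (⊗-of-effects bra1 bra1) ⟩
  (ket0 ⊗ ket0) ⨾ cnot ⨾ ((bra1 ⊗ id 1) ⨾ bra1)
    ≈⟨ ⨾-assoc _ _ _ ⟩
  (ket0 ⊗ ket0) ⨾ (cnot ⨾ ((bra1 ⊗ id 1) ⨾ bra1))
    ≈⟨ ⨾-cong ≈-refl (⨾-assoc _ _ _) ⟨
  (ket0 ⊗ ket0) ⨾ (cnot ⨾ (bra1 ⊗ id 1) ⨾ bra1)
    ≈⟨ ⨾-cong ≈-refl (⨾-cong cnot-⨾-bra1⊗id ≈-refl) ⟩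
  (ket0 ⊗ ket0) ⨾ ((bra1 ⊗ id 1) ⨾ not ⨾ bra1)
    ≈⟨ ⨾-cong ≈-refl (⨾-assoc _ _ _) ⟩
  (ket0 ⊗ ket0) ⨾ ((bra1 ⊗ id 1) ⨾ (not ⨾ bra1))
    ≈⟨ ⨾-assoc _ _ _ ⟨
  (ket0 ⊗ ket0) ⨾ (bra1 ⊗ id 1) ⨾ (not ⨾ bra1) ∎

ket0⨾not⨾bra1 : ket0 ⨾ (not ⨾ bra1) ≈ id 0
ket0⨾not⨾bra1 = begin
  ket0 ⨾ (not ⨾ bra1) ≈⟨ ⨾-assoc _ _ _ ⟨
  ket0 ⨾ not ⨾ bra1   ≈⟨ ⨾-cong ket0⨾not ≈-refl ⟩
  ket1 ⨾ bra1         ≈⟨ r6 ⟩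
  id 0                ∎

mainTheorem14 : Ω ⊗ Ω ≈ Ω
mainTheorem14 = begin
  Ω ⊗ Ω
    ≈⟨ ⊗-cong Ω≈ket0⨾bra1 Ω≈ket0⨾bra1 ⟩
  (ket0 ⨾ bra1) ⊗ (ket0 ⨾ bra1)
    ≈⟨ interchange ket0 bra1 ket0 bra1 ⟩
  (ket0 ⊗ ket0) ⨾ (bra1 ⊗ bra1)
    ≈⟨ ket0⊗ket0-⨾-bra1⊗bra1 ⟩
  (ket0 ⊗ ket0) ⨾ (bra1 ⊗ id 1) ⨾ (not ⨾ bra1)
    ≈⟨ ⨾-cong (interchange ket0 bra1 ket0 (id 1)) (⊗-unitˡ _) ⟨
  ((ket0 ⨾ bra1) ⊗ (ket0 ⨾ id 1)) ⨾ (id 0 ⊗ (not ⨾ bra1))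
    ≈⟨ interchange _ _ _ _ ⟨
  ((ket0 ⨾ bra1) ⨾ id 0) ⊗ ((ket0 ⨾ id 1) ⨾ (not ⨾ bra1))
    ≈⟨ ⊗-cong (⨾-idʳ _) (⨾-cong (⨾-idʳ ket0) ≈-refl) ⟩
  (ket0 ⨾ bra1) ⊗ (ket0 ⨾ (not ⨾ bra1))
    ≈⟨ ⊗-cong (≈-sym Ω≈ket0⨾bra1) ket0⨾not⨾bra1 ⟩
  Ω ⊗ id 0
    ≈⟨ ⊗-unitʳ Ω ⟩
  Ω ∎
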